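{- Let $X$ be a sock ordering that contains a sandwich, and let $aba$ be the first sandwich to appear in $X$. Then every color of $X$ other than $a$ and $b$ is either sortable in $X$ or blocked by the sandwich $aba$.
   Context: Sock orderings are finite words of colored socks written as words over colors; $Y\subseteq X$ means $Y$ is a subsequence of $X$. A sandwich is a word $uvu$ with colors $u\ne v$; it blocks a color $z\notin\{u,v\}$ in $X$ if $uvuz\subseteq X$. A color is sortable in $X$ if it is not blocked by any sandwich in $X$. Order of sandwiches: for sandwiches $aba$ and $xyx$ in $X$, if $a\ne x$ then $aba$ appears earlier if its second $a$ comes before the second $x$ (taking earliest occurrences); if $x=a$, then $aba$ is earlier than $aya$ if the $b$ occurs before the $y$. The first sandwich is the earliest one in this sense. -}

module Defs where

open import Data.Nat using (ℕ)
open import Data.List using (List; []; _∷_; take)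
open import Data.List.Relation.Binary.Sublist.Propositional using (_⊆_)
open import Data.Product using (_×_; ∃)
open import Data.Sum using (_⊎_)
open import Relation.Nullary using (¬_)
open import Relation.Binary.PropositionalEquality using (_≡_; _≢_)

-- Colors are natural numbers; a sock ordering is a finite word over colors.
Color : Set
Color = ℕ

Word : Set
Word = List Color

IsSandwich : Word → Color → Color → Set
IsSandwich X u v = u ≢ v × (u ∷ v ∷ u ∷ []) ⊆ X

Blocks : Word → Color → Color → Color → Set
Blocks X u v z = u ≢ v × z ≢ u × z ≢ v × (u ∷ v ∷ u ∷ z ∷ []) ⊆ X

Sortable : Word → Color → Set
Sortable X z = ∀ u v → ¬ Blocks X u v z

-- Earliest occurrence comparison: word w (embedded greedily, i.e. at its
-- earliest occurrence) ends strictly before word w' ends iff some prefix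
-- of X contains w as a subsequence but not w'.
EndsBefore : Word → Word → Word → Set
EndsBefore X w w' = ∃ λ n → w ⊆ take n X × ¬ (w' ⊆ take n X)

Earlier : Word → Color → Color → Color → Color → Set
Earlier X a b x y =
    (a ≢ x × EndsBefore X (a ∷ b ∷ a ∷ []) (x ∷ y ∷ x ∷ []))
  ⊎ (a ≡ x × EndsBefore X (a ∷ b ∷ []) (a ∷ y ∷ []))

FirstSandwich : Word → Color → Color → Set
FirstSandwich X a b =
  IsSandwich X a b ×
  (∀ x y → IsSandwich X x y → ¬ (x ≡ a × y ≡ b) → Earlier X a b x y)

{-# OPTIONS --safe #-}
module Submission where

-- If a sandwich u v u blocks z, the first sandwich a b a is complete by the time u v u is
-- (when u = a: a b is complete by the time a v is), so the z after u v u also follows a b a.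
-- Comparing completion times reduces to prefixes of X: if w fits into a prefix that w′
-- does not fit into, then w fits into every prefix that w′ fits into.

open import Defs
open import Data.List.Membership.Propositional using (_∈_)
open import Data.Sum using (_⊎_; inj₁; inj₂)
open import Relation.Binary.PropositionalEquality using (_≢_; refl; subst)
open import Data.Nat using (_≤_; suc; _≟_)
open import Data.Nat.Properties using (≤-total)
open import Data.List using (List; []; _∷_; _++_; take; drop)
open import Data.List.Properties using (take++drop≡id)
open import Data.List.Relation.Binary.Sublist.Propositional using (_⊆_; []; _∷_; _∷ʳ_; ⊆-refl; ⊆-trans)
open import Data.List.Relation.Binary.Sublist.Propositional.Properties using (++⁺; ++⁺ʳ; take⁺)
open import Data.List.Relation.Binary.Sublist.DecPropositional _≟_ using (_⊆?_)
open import Data.Product using (_×_; _,_; ∃)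
open import Relation.Nullary using (yes; no)
open import Relation.Nullary.Decidable using (_×-dec_)
open import Data.Empty using (⊥-elim)

++⊆-split : ∀ {A : Set} (xs ys : List A) {X : List A} →
            xs ++ ys ⊆ X → ∃ λ m → xs ⊆ take m X × ys ⊆ drop m X
++⊆-split []       ys         p         = 0 , [] , p
++⊆-split (x ∷ xs) ys {y ∷ X} (.y ∷ʳ p) with ++⊆-split (x ∷ xs) ys p
... | m , xs⊆ , ys⊆ = suc m , y ∷ʳ xs⊆ , ys⊆
++⊆-split (x ∷ xs) ys {y ∷ X} (x≡y ∷ p) with ++⊆-split xs ys p
... | m , xs⊆ , ys⊆ = suc m , x≡y ∷ xs⊆ , ys⊆

++⊆-join : ∀ {A : Set} {xs ys X : List A} m →
           xs ⊆ take m X → ys ⊆ drop m X → xs ++ ys ⊆ X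
++⊆-join {X = X} m xs⊆ ys⊆ = subst (_ ⊆_) (take++drop≡id m X) (++⁺ xs⊆ ys⊆)

EndsBefore-++ : ∀ {X w} w′ t → EndsBefore X w w′ → w′ ++ t ⊆ X → w ++ t ⊆ X
EndsBefore-++ w′ t (n , w⊆Xₙ , w′⊈Xₙ) w′t⊆X with ++⊆-split w′ t w′t⊆X
... | m , w′⊆Xₘ , t⊆ = ++⊆-join m (⊆-trans w⊆Xₙ (take⁺ n≤m)) t⊆
  where
  n≤m : n ≤ m
  n≤m with ≤-total n m
  ... | inj₁ n≤m = n≤m
  ... | inj₂ m≤n = ⊥-elim (w′⊈Xₙ (⊆-trans w′⊆Xₘ (take⁺ m≤n)))

Earlier-++ : ∀ {X a b u v} t → Earlier X a b u v →
             u ∷ v ∷ u ∷ t ⊆ X → a ∷ b ∷ a ∷ t ⊆ X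
Earlier-++ {u = u} {v} t (inj₁ (_ , aba<uvu)) = EndsBefore-++ (u ∷ v ∷ u ∷ []) t aba<uvu
Earlier-++ {u = u} {v} t (inj₂ (refl , ab<uv)) = EndsBefore-++ (u ∷ v ∷ []) (u ∷ t) ab<uv

FirstSandwich-++ : ∀ {X a b u v} t → FirstSandwich X a b → u ≢ v →
                   u ∷ v ∷ u ∷ t ⊆ X → a ∷ b ∷ a ∷ t ⊆ X
FirstSandwich-++ {X} {a} {b} {u} {v} t (_ , first) u≢v uvut⊆X with u ≟ a ×-dec v ≟ b
... | yes (refl , refl) = uvut⊆X
... | no ≢ab = Earlier-++ t (first u v (u≢v , uvu⊆X) ≢ab) uvut⊆X
  where
  uvu⊆X : u ∷ v ∷ u ∷ [] ⊆ X
  uvu⊆X = ⊆-trans (++⁺ʳ t ⊆-refl) uvut⊆X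

mainTheorem5 : (X : Word) (a b : Color) → FirstSandwich X a b →
    ∀ z → z ∈ X → z ≢ a → z ≢ b → Sortable X z ⊎ Blocks X a b z
mainTheorem5 X a b first@((a≢b , _) , _) z _ z≢a z≢b with a ∷ b ∷ a ∷ z ∷ [] ⊆? X
... | yes abaz⊆X = inj₂ (a≢b , z≢a , z≢b , abaz⊆X)
... | no abaz⊈X  = inj₁ λ u v (u≢v , _ , _ , uvuz⊆X) →
                     abaz⊈X (FirstSandwich-++ (z ∷ []) first u≢v uvuz⊆X)
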